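{- Let $T$ be a tree, let $B \subseteq \mathbb{N}$ be a finite nonempty set and $p = \max B$. Let $P$ be a path in $T$ with distinct endpoints $u$ and $v$. Let $T_1$ (resp. $T_2$) be the connected component of $T \setminus (V(P)\setminus\{u,v\})$ containing $u$ (resp. $v$), and let $T' = T_1 \cup T_2 + uv$ be the tree obtained from $T_1$ and $T_2$ by adding the edge $uv$. If $T'$ is $(B\setminus\{p\})$-burnable, then $T$ is $B$-burnable unless $$ d(u,v) + 2\max_{x \in V(T)\setminus V(T_1\cup T_2)} d(P,x) \geq 2p+3. $$
   Context: For a graph $G$ and a set (not a multiset) $B = \{b_1,\dots,b_j\} \subseteq \mathbb{N}$, $G$ is $B$-burnable if there exist vertices $v_1,\dots,v_j$ of $G$ with $\bigcup_{i=1}^{j} N_{b_i}[v_i] = V(G)$, where $N_r[v]$ is the set of vertices at distance at most $r$ from $v$. $d$ denotes graph distance in $T$ and $d(P,x)$ the distance from $x$ to the nearest vertex of $P$. -}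

module Defs where

open import Data.Nat using (ℕ; zero; suc; _≤_; _≟_)
open import Data.Fin using (Fin)
open import Data.List using (List; []; _∷_; length; lookup; filter)
open import Data.List.Membership.Propositional using (_∈_)
open import Data.List.Relation.Unary.Unique.Propositional using (Unique)
open import Data.List.Relation.Unary.Linked using (Linked)
open import Data.List.Relation.Unary.AllPairs using ()
open import Data.Product using (Σ; ∃; _×_; _,_)
open import Data.Sum using (_⊎_)
open import Data.Empty using (⊥)
open import Relation.Nullary using (¬_)
open import Relation.Nullary.Decidable using (¬?)
open import Relation.Binary.PropositionalEquality using (_≡_)

record Graph (n : ℕ) : Set₁ where
  field
    Adj    : Fin n → Fin n → Set
    sym    : ∀ {x y} → Adj x y → Adj y x
    irrefl : ∀ {x} → ¬ Adj x x
open Graph public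

data Walk {n : ℕ} (R : Fin n → Fin n → Set) : Fin n → Fin n → ℕ → Set where
  here : ∀ {x} → Walk R x x 0
  step : ∀ {x y z k} → R x y → Walk R y z k → Walk R x z (suc k)

Within : ∀ {n} → (Fin n → Fin n → Set) → Fin n → Fin n → ℕ → Set
Within R x y r = ∃ λ k → k ≤ r × Walk R x y k

Dist : ∀ {n} → (Fin n → Fin n → Set) → Fin n → Fin n → ℕ → Set
Dist R x y k = Walk R x y k × (∀ k' → Walk R x y k' → k ≤ k')

DistToSet : ∀ {n} → (Fin n → Fin n → Set) → List (Fin n) → Fin n → ℕ → Set
DistToSet R P x k =
  (∃ λ y → y ∈ P × Walk R y x k) × (∀ y k' → y ∈ P → Walk R y x k' → k ≤ k')

Connected : ∀ {n} → Graph n → Set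
Connected G = ∀ x y → ∃ λ k → Walk (Adj G) x y k

IsCycle : ∀ {n} → Graph n → List (Fin n) → Set
IsCycle G [] = ⊥
IsCycle G (x ∷ xs) =
  3 ≤ length (x ∷ xs) × Unique (x ∷ xs) × Linked (Adj G) (x ∷ xs) × LastAdj xs
  where
    LastAdj : List _ → Set
    LastAdj [] = ⊥
    LastAdj (y ∷ []) = Adj G y x
    LastAdj (y ∷ z ∷ zs) = LastAdj (z ∷ zs)

Acyclic : ∀ {n} → Graph n → Set
Acyclic G = ∀ cs → ¬ IsCycle G cs

IsTree : ∀ {n} → Graph n → Set
IsTree G = Connected G × Acyclic G

IsPath : ∀ {n} → Graph n → List (Fin n) → Set
IsPath G xs = Unique xs × Linked (Adj G) xs

-- G (with adjacency R, vertex set S) is B-burnable, B given as a duplicate-free list: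
-- one center per element b_i of B, with ⋃ N_{b_i}[v_i] = S.
Burnable : ∀ {n} → (Fin n → Fin n → Set) → (Fin n → Set) → List ℕ → Set
Burnable {n} R S B =
  Σ (Fin (length B) → Fin n) λ c →
    (∀ i → S (c i)) × (∀ x → S x → ∃ λ i → Within R (c i) x (lookup B i))

remove : List ℕ → ℕ → List ℕ
remove B p = filter (λ b → ¬? (b ≟ p)) B

-- Setting: tree T, path P = u ∷ I ++ [v] with interior vertex list I.
module Setting {n : ℕ} (T : Graph n) (u v : Fin n) (I : List (Fin n)) where

  AdjMinus : Fin n → Fin n → Set
  AdjMinus x y = Adj T x y × ¬ (x ∈ I) × ¬ (y ∈ I)

  InT₁ : Fin n → Set
  InT₁ x = ∃ λ k → Walk AdjMinus u x k

  InT₂ : Fin n → Set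
  InT₂ x = ∃ λ k → Walk AdjMinus v x k

  V' : Fin n → Set
  V' x = InT₁ x ⊎ InT₂ x

  Adj' : Fin n → Fin n → Set
  Adj' x y = (InT₁ x × InT₁ y × Adj T x y) ⊎ (InT₂ x × InT₂ y × Adj T x y)
           ⊎ (x ≡ u × y ≡ v) ⊎ (x ≡ v × y ≡ u)

  Outside : Fin n → Set
  Outside x = ¬ V' x

  -- M = max_{x ∈ V(T) \ V(T₁ ∪ T₂)} d(P,x)   (M = 0 if that set is empty)
  IsMaxOut : List (Fin n) → ℕ → Set
  IsMaxOut P M =
    (∀ x k → Outside x → DistToSet (Adj T) P x k → k ≤ M) ×
    ((∃ λ x → Outside x × DistToSet (Adj T) P x M) ⊎ ((∀ x → ¬ Outside x) × M ≡ 0))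

{-# OPTIONS --safe #-}
-- The balls of a (B ∖ {p})-burning of T′ remain balls in T, except that whatever a ball covered by
-- crossing the new edge uv is lost. If the balls reach α past u and β past v, every vertex they miss
-- in T lies in T₂ within distance α − 2 of v, in T₁ within distance β − 2 of u, or hangs at depth
-- k ≤ M below the vertex at position w of P with w + k ≥ α and d(u,v) − w + k ≥ β. When β ≤ α, the
-- ball of radius p centred at position max(0, d(u,v) + α − p − 2, d(u,v) + M − p − 1) of P covers all
-- of them as soon as d(u,v) + 2M ≤ 2p + 2; when α < β, the same holds with P reversed.
module Submission where

open import Defs
open import Data.Nat using (ℕ; zero; suc; _+_; _*_; _∸_; _⊔_; _≤_; _<_; _≤?_; _<?_; _≟_; _≡ᵇ_; z≤n; s≤s; ∣_-_∣)
open import Data.Nat.Properties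
open import Data.Nat.Tactic.RingSolver using (solve-∀)
open import Data.Fin using (Fin; zero; suc) renaming (_≟_ to _≟ᶠ_)
open import Data.Fin.Properties using (any?)
open import Data.List using (List; []; _∷_; _++_; length; lookup)
open import Data.List.Membership.Propositional using (_∈_; _∉_)
open import Data.List.Membership.Propositional.Properties using (∈-++⁺ˡ; ∈-++⁺ʳ; ∈-++⁻; ∈-filter⁻; ∈-lookup)
open import Data.List.Relation.Binary.Subset.Propositional using (_⊆_)
open import Data.List.Extrema ≤-totalOrder using (argmin; argmin-sel; f[argmin]≤f[⊤]; f[argmin]≤f[xs])
open import Data.List.Relation.Unary.Any using (here; there)
open import Data.List.Relation.Unary.All as All using (All; []; _∷_)
open import Data.List.Relation.Unary.All.Properties using (¬Any⇒All¬; All¬⇒¬Any)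
open import Data.List.Relation.Unary.AllPairs using ([]; _∷_)
open import Data.List.Relation.Unary.Linked using (Linked; []; [-]; _∷_)
open import Data.List.Relation.Unary.Unique.Propositional using (Unique)
open import Data.Product using (Σ; ∃; _×_; _,_; proj₁; proj₂)
open import Data.Sum as Sum using (_⊎_; inj₁; inj₂; [_,_]′)
open import Data.Empty using (⊥-elim)
open import Data.Unit using (⊤; tt)
open import Data.Bool using (true; false; T)
open import Function using (_∘_; id)
open import Relation.Nullary using (¬_; Dec; yes; no; ¬?)
open import Relation.Nullary.Decidable using (decidable-stable; _⊎-dec_)
open import Relation.Binary.PropositionalEquality
  using (_≡_; _≢_; refl; cong; cong₂; subst; subst₂; trans; module ≡-Reasoning) renaming (sym to ≡-sym)

∣[d∸i]-[d∸j]∣≡∣i-j∣ : ∀ {d i j} → i ≤ d → j ≤ d → ∣ d ∸ i - d ∸ j ∣ ≡ ∣ i - j ∣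
∣[d∸i]-[d∸j]∣≡∣i-j∣ {d} {i} {j} i≤d j≤d = begin
  ∣ d ∸ i - d ∸ j ∣                     ≡⟨ ∣m+n-m+o∣≡∣n-o∣ (i + j) (d ∸ i) (d ∸ j) ⟨
  ∣ i + j + (d ∸ i) - i + j + (d ∸ j) ∣ ≡⟨ cong₂ ∣_-_∣ (complete i j i≤d) (trans (cong (_+ (d ∸ j)) (+-comm i j)) (complete j i j≤d)) ⟩
  ∣ d + j - d + i ∣                     ≡⟨ ∣m+n-m+o∣≡∣n-o∣ d j i ⟩
  ∣ j - i ∣                             ≡⟨ ∣-∣-comm j i ⟩
  ∣ i - j ∣                             ∎
  where
    open ≡-Reasoning
    complete : ∀ a b → a ≤ d → a + b + (d ∸ a) ≡ d + b
    complete a b a≤d = trans (+-comm-middle a b (d ∸ a)) (cong (_+ b) (m+[n∸m]≡n a≤d))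
      where
        +-comm-middle : ∀ x y z → x + y + z ≡ x + z + y
        +-comm-middle = solve-∀

∣a-b∣+k≤p : ∀ {a b k p} → a + k ≤ b + p → b + k ≤ a + p → ∣ a - b ∣ + k ≤ p
∣a-b∣+k≤p {a} {b} {k} {p} h₁ h₂ = [ a≤b⇒ , b≤a⇒ ]′ (≤-total a b)
  where
    ∸+≤ : ∀ {a b} → a ≤ b → b + k ≤ a + p → b ∸ a + k ≤ p
    ∸+≤ {a} {b} a≤b h = subst (_≤ p) (+-∸-comm k a≤b) (m≤n+o⇒m∸n≤o (b + k) a h)
    a≤b⇒ : a ≤ b → ∣ a - b ∣ + k ≤ p
    a≤b⇒ a≤b = subst (λ m → m + k ≤ p) (≡-sym (m≤n⇒∣m-n∣≡n∸m a≤b)) (∸+≤ a≤b h₂)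
    b≤a⇒ : b ≤ a → ∣ a - b ∣ + k ≤ p
    b≤a⇒ b≤a = subst (λ m → m + k ≤ p) (≡-sym (m≤n⇒∣n-m∣≡n∸m b≤a)) (∸+≤ b≤a h₁)

∸-zero-or-exact : ∀ m n → m ∸ n ≡ 0 ⊎ m ∸ n + n ≡ m
∸-zero-or-exact m n with ≤-total n m
... | inj₁ n≤m = inj₂ (m∸n+n≡m n≤m)
... | inj₂ m≤n = inj₁ (m≤n⇒m∸n≡0 m≤n)

<1+∸⇒+≤ : ∀ {t r d} → t < suc r ∸ d → d + t ≤ r
<1+∸⇒+≤ {t} {r} {d} t<1+r∸d = ≤-pred (subst (_≤ suc r) (trans (+-comm (suc t) d) (+-suc d t)) (m≤o∸n⇒m+n≤o (suc t) d≤1+r t<1+r∸d))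
  where
    d≤1+r : d ≤ suc r
    d≤1+r = <⇒≤ (m∸n≢0⇒n<m λ eq → n≮0 (subst (t <_) eq t<1+r∸d))

m+1+n≤o⇒n≤o : ∀ {m n o} → m + 1 + n ≤ o → n ≤ o
m+1+n≤o⇒n≤o {m} {n} = ≤-trans (m≤n+m n (m + 1))

sup : ∀ {m} → (Fin m → ℕ) → ℕ
sup {zero}  f = 0
sup {suc m} f = f zero ⊔ sup (f ∘ suc)

f≤sup : ∀ {m} (f : Fin m → ℕ) i → f i ≤ sup f
f≤sup f zero    = m≤m⊔n _ _
f≤sup f (suc i) = ≤-trans (f≤sup (f ∘ suc) i) (m≤n⊔m _ _)

sup≤ : ∀ {m b} (f : Fin m → ℕ) → (∀ i → f i ≤ b) → sup f ≤ b
sup≤ {zero}  f _ = z≤n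
sup≤ {suc m} f h = ⊔-lub (h zero) (sup≤ (f ∘ suc) (h ∘ suc))

<sup⇒ : ∀ {m t} (f : Fin m → ℕ) → t < sup f → ∃ λ i → t < f i
<sup⇒ {suc m} {t} f t<sup with ⊔-sel (f zero) (sup (f ∘ suc))
... | inj₁ eq = zero , subst (t <_) eq t<sup
... | inj₂ eq = let i , t<f = <sup⇒ (f ∘ suc) (subst (t <_) eq t<sup) in suc i , t<f

module _ {d M p α : ℕ} (α≤p : α ≤ p) (short : d + 2 * M ≤ 2 * p + 2) where

  M≤1+p : M ≤ 1 + p
  M≤1+p = *-cancelˡ-≤ 2 (≤-trans (m≤n+m (2 * M) d) (≤-trans short (≤-reflexive (2p+2≡2[1+p] p))))
    where
      2p+2≡2[1+p] : ∀ p → 2 * p + 2 ≡ 2 * (1 + p)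
      2p+2≡2[1+p] = solve-∀

  centre-index : ∃ λ σ → σ ≤ d × d + α ≤ σ + (2 + p) × d + M ≤ σ + (1 + p) ×
                         (σ + 2 * M ≤ p + α ⊎ σ + M ≤ p + 1)
  centre-index = X ⊔ Y , ⊔-lub X≤d Y≤d
               , ≤-trans (exceed (d + α) (2 + p)) (+-monoˡ-≤ (2 + p) (m≤m⊔n X Y))
               , ≤-trans (exceed (d + M) (1 + p)) (+-monoˡ-≤ (1 + p) (m≤n⊔m X Y))
               , [ (λ σ≡X → subst Low (≡-sym σ≡X) low-X) , (λ σ≡Y → subst Low (≡-sym σ≡Y) low-Y) ]′ (⊔-sel X Y)
    where
      open ≤-Reasoning
      X Y : ℕ
      X = d + α ∸ (2 + p)
      Y = d + M ∸ (1 + p)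

      exceed : ∀ m n → m ≤ m ∸ n + n
      exceed m n = subst (m ≤_) (+-comm n (m ∸ n)) (m≤n+m∸n m n)

      X≤d : X ≤ d
      X≤d = m≤n+o⇒m∸n≤o (d + α) (2 + p) (subst (d + α ≤_) (+-comm d (2 + p)) (+-monoʳ-≤ d (m≤n⇒m≤o+n 2 α≤p)))
      Y≤d : Y ≤ d
      Y≤d = m≤n+o⇒m∸n≤o (d + M) (1 + p) (subst (d + M ≤_) (+-comm d (1 + p)) (+-monoʳ-≤ d M≤1+p))

      Low : ℕ → Set
      Low σ = σ + 2 * M ≤ p + α ⊎ σ + M ≤ p + 1

      low-0 : Low 0
      low-0 = inj₂ (subst (M ≤_) (+-comm 1 p) M≤1+p)

      low-X : Low X
      low-X with ∸-zero-or-exact (d + α) (2 + p)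
      ... | inj₁ X≡0 = subst Low (≡-sym X≡0) low-0
      ... | inj₂ X+2+p≡d+α = inj₁ (+-cancelʳ-≤ (2 + p) (X + 2 * M) (p + α) (begin
        X + 2 * M + (2 + p)   ≡⟨ swap X (2 * M) (2 + p) ⟩
        X + (2 + p) + 2 * M   ≡⟨ cong (_+ 2 * M) X+2+p≡d+α ⟩
        d + α + 2 * M         ≡⟨ swap d α (2 * M) ⟩
        d + 2 * M + α         ≤⟨ +-monoˡ-≤ α short ⟩
        2 * p + 2 + α         ≡⟨ regroup p α ⟩
        p + α + (2 + p)       ∎))
        where
          swap : ∀ a b c → a + b + c ≡ a + c + b
          swap = solve-∀
          regroup : ∀ p α → 2 * p + 2 + α ≡ p + α + (2 + p)
          regroup = solve-∀

      low-Y : Low Y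
      low-Y with ∸-zero-or-exact (d + M) (1 + p)
      ... | inj₁ Y≡0 = subst Low (≡-sym Y≡0) low-0
      ... | inj₂ Y+1+p≡d+M = inj₂ (+-cancelʳ-≤ (1 + p) (Y + M) (p + 1) (begin
        Y + M + (1 + p)       ≡⟨ swap Y M (1 + p) ⟩
        Y + (1 + p) + M       ≡⟨ cong (_+ M) Y+1+p≡d+M ⟩
        d + M + M             ≡⟨ double d M ⟩
        d + 2 * M             ≤⟨ short ⟩
        2 * p + 2             ≡⟨ regroup p ⟩
        p + 1 + (1 + p)       ∎))
        where
          swap : ∀ a b c → a + b + c ≡ a + c + b
          swap = solve-∀
          double : ∀ d M → d + M + M ≡ d + 2 * M
          double = solve-∀
          regroup : ∀ p → 2 * p + 2 ≡ p + 1 + (1 + p)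
          regroup = solve-∀

unique-snoc⇒∉ : ∀ {A : Set} {y : A} (xs : List A) → Unique (xs ++ y ∷ []) → y ∉ xs
unique-snoc⇒∉ (x ∷ xs) (x∉ ∷ _) (here refl) = All¬⇒¬Any x∉ (∈-++⁺ʳ xs (here refl))
unique-snoc⇒∉ (x ∷ xs) (_ ∷ u)  (there y∈) = unique-snoc⇒∉ xs u y∈

module _ {n : ℕ} {R : Fin n → Fin n → Set} where

  vertices : ∀ {x z k} → Walk R x z k → List (Fin n)
  vertices {x} here       = x ∷ []
  vertices {x} (step _ w) = x ∷ vertices w

  Simple : ∀ {x z k} → Walk R x z k → Set
  Simple w = Unique (vertices w)

  end∈vertices : ∀ {x z k} (w : Walk R x z k) → z ∈ vertices w
  end∈vertices here       = here refl
  end∈vertices (step _ w) = there (end∈vertices w)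

  length-vertices : ∀ {x z k} (w : Walk R x z k) → length (vertices w) ≡ suc k
  length-vertices here       = refl
  length-vertices (step _ w) = cong suc (length-vertices w)

  linked-vertices : ∀ {x z k} (w : Walk R x z k) → Linked R (vertices w)
  linked-vertices here                = [-]
  linked-vertices (step e here)       = e ∷ [-]
  linked-vertices (step e (step f w)) = e ∷ linked-vertices (step f w)

  _++ʷ_ : ∀ {x y z k l} → Walk R x y k → Walk R y z l → Walk R x z (k + l)
  here     ++ʷ w′ = w′
  step e w ++ʷ w′ = step e (w ++ʷ w′)

  vertices-++ʷ : ∀ {x y z k l} (w : Walk R x y k) (w′ : Walk R y z l) →
                 vertices (w ++ʷ w′) ⊆ vertices w ++ vertices w′
  vertices-++ʷ here       w′ a∈         = there a∈
  vertices-++ʷ (step e w) w′ (here eq)  = here eq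
  vertices-++ʷ (step e w) w′ (there a∈) = there (vertices-++ʷ w w′ a∈)

  _▷_ : ∀ {x y z k} → Walk R x y k → R y z → Walk R x z (suc k)
  here     ▷ e = step e here
  step f w ▷ e = step f (w ▷ e)

  vertices-▷ : ∀ {x y z k} (w : Walk R x y k) (e : R y z) → vertices (w ▷ e) ≡ vertices w ++ z ∷ []
  vertices-▷ here       e = refl
  vertices-▷ (step f w) e = cong (_ ∷_) (vertices-▷ w e)

  module _ (R-sym : ∀ {x y} → R x y → R y x) where

    reverseʷ : ∀ {x z k} → Walk R x z k → Walk R z x k
    reverseʷ here       = here
    reverseʷ (step e w) = reverseʷ w ▷ R-sym e

    vertices-reverseʷ : ∀ {x z k} (w : Walk R x z k) → vertices (reverseʷ w) ⊆ vertices w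
    vertices-reverseʷ here a∈ = a∈
    vertices-reverseʷ (step e w) a∈
      with ∈-++⁻ (vertices (reverseʷ w)) (subst (_ ∈_) (vertices-▷ (reverseʷ w) (R-sym e)) a∈)
    ... | inj₁ a∈w         = there (vertices-reverseʷ w a∈w)
    ... | inj₂ (here refl) = here refl

  suffix-from : ∀ {x z k a} (w : Walk R x z k) → a ∈ vertices w →
                ∃ λ k′ → k′ ≤ k × Σ (Walk R a z k′) λ w′ →
                  vertices w′ ⊆ vertices w × (Simple w → Simple w′)
  suffix-from here       (here refl) = 0 , ≤-refl , here , id , id
  suffix-from (step e w) (here refl) = _ , ≤-refl , step e w , id , id
  suffix-from (step e w) (there a∈) with suffix-from w a∈
  ... | k′ , k′≤k , w′ , sub , simple =
    k′ , m≤n⇒m≤1+n k′≤k , w′ , there ∘ sub , λ { (_ ∷ u) → simple u }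

  open import Data.List.Membership.DecPropositional (_≟ᶠ_ {n}) using (_∈?_)

  erase-loops : ∀ {x z k} (w : Walk R x z k) →
                ∃ λ k′ → k′ ≤ k × Σ (Walk R x z k′) λ w′ → Simple w′ × vertices w′ ⊆ vertices w
  erase-loops here = 0 , z≤n , here , [] ∷ [] , id
  erase-loops (step {x} e w) with erase-loops w
  ... | k′ , k′≤k , w′ , simple , sub with x ∈? vertices w′
  ...   | yes x∈ = let k″ , k″≤k′ , w″ , sub′ , simple′ = suffix-from w′ x∈
                   in k″ , m≤n⇒m≤1+n (≤-trans k″≤k′ k′≤k) , w″ , simple′ simple , there ∘ sub ∘ sub′
  ...   | no x∉ = suc k′ , s≤s k′≤k , step e w′ , ¬Any⇒All¬ _ x∉ ∷ simple ,
                  λ { (here eq) → here eq ; (there a∈) → there (sub a∈) }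

  vertex-at : ∀ {x z k} → Walk R x z k → ℕ → Fin n
  vertex-at {x} _          zero    = x
  vertex-at {x} here       (suc _) = x
  vertex-at     (step _ w) (suc i) = vertex-at w i

  vertex-at-end : ∀ {x z k} (w : Walk R x z k) → vertex-at w k ≡ z
  vertex-at-end here       = refl
  vertex-at-end (step _ w) = vertex-at-end w

  vertex-at-index : ∀ {x z k a} (w : Walk R x z k) → a ∈ vertices w → ∃ λ i → i ≤ k × vertex-at w i ≡ a
  vertex-at-index here       (here refl) = 0 , z≤n , refl
  vertex-at-index (step _ w) (here refl) = 0 , z≤n , refl
  vertex-at-index (step _ w) (there a∈) with vertex-at-index w a∈
  ... | i , i≤k , eq = suc i , s≤s i≤k , eq

  prefix : ∀ {x z k i} (w : Walk R x z k) → i ≤ k → Walk R x (vertex-at w i) i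
  prefix {i = zero}  w          _         = here
  prefix {i = suc i} (step e w) (s≤s i≤k) = step e (prefix w i≤k)

  segment : ∀ {x z k i j} (w : Walk R x z k) → i ≤ j → j ≤ k →
            Walk R (vertex-at w i) (vertex-at w j) (j ∸ i)
  segment {i = zero}  w          _         j≤k       = prefix w j≤k
  segment {i = suc i} (step _ w) (s≤s i≤j) (s≤s j≤k) = segment w i≤j j≤k

  linked⇒walk : ∀ {y} x (xs : List (Fin n)) → Linked R (x ∷ xs ++ y ∷ []) → Walk R x y (suc (length xs))
  linked⇒walk x []       (e ∷ [-]) = step e here
  linked⇒walk x (z ∷ xs) (e ∷ l)   = step e (linked⇒walk z xs l)

  vertices-linked⇒walk : ∀ {y} x (xs : List (Fin n)) (l : Linked R (x ∷ xs ++ y ∷ [])) →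
                         vertices (linked⇒walk x xs l) ≡ x ∷ xs ++ y ∷ []
  vertices-linked⇒walk x []       (e ∷ [-]) = refl
  vertices-linked⇒walk x (z ∷ xs) (e ∷ l)   = cong (x ∷_) (vertices-linked⇒walk z xs l)

  avoiding : ∀ {Q : Fin n → Set} {a x k} (w : Walk R a x k) → ¬ Q a →
             (∀ {q k′} → Q q → Walk R q x k′ → k ≤ k′) →
             Walk (λ y z → R y z × ¬ Q y × ¬ Q z) a x k
  avoiding here       _   _       = here
  avoiding (step e w) ¬Qa shorter = step (e , ¬Qa , ¬Qb) (avoiding w ¬Qb λ Qq w′ → ≤-trans (n≤1+n _) (shorter Qq w′))
    where
      ¬Qb = λ Qb → 1+n≰n (shorter Qb w)

record Ruler {n : ℕ} (R : Fin n → Fin n → Set) (d : ℕ) : Set where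
  field
    point   : ℕ → Fin n
    between : ∀ {i j} → i ≤ d → j ≤ d → Walk R (point i) (point j) ∣ i - j ∣
open Ruler

module _ {n : ℕ} {R : Fin n → Fin n → Set} where

  walk-ruler : (∀ {x y} → R x y → R y x) → ∀ {x z d} → Walk R x z d → Ruler R d
  walk-ruler R-sym {d = d} w = record { point = vertex-at w ; between = between′ }
    where
      between′ : ∀ {i j} → i ≤ d → j ≤ d → Walk R (vertex-at w i) (vertex-at w j) ∣ i - j ∣
      between′ {i} {j} i≤d j≤d with ≤-total i j
      ... | inj₁ i≤j = subst (Walk R _ _) (≡-sym (m≤n⇒∣m-n∣≡n∸m i≤j)) (segment w i≤j j≤d)
      ... | inj₂ j≤i = subst (Walk R _ _) (≡-sym (m≤n⇒∣n-m∣≡n∸m j≤i)) (reverseʷ R-sym (segment w j≤i i≤d))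

  reverse-ruler : ∀ {d} → Ruler R d → Ruler R d
  reverse-ruler {d} L = record
    { point   = λ i → point L (d ∸ i)
    ; between = λ {i} {j} i≤d j≤d →
        subst (Walk R _ _) (∣[d∸i]-[d∸j]∣≡∣i-j∣ i≤d j≤d) (between L (m∸n≤m d i) (m∸n≤m d j))
    }

module _ {n : ℕ} (G : Graph n) where

  -- The closing-edge condition of a cycle is local to IsCycle; it is reached as IsCycle's last component.
  ClosingEdge : Fin n → List (Fin n) → Set
  ClosingEdge x xs = last-component (refl {x = IsCycle G (x ∷ xs)})
    where
      last-component : {A B C D : Set} → (A × B × C × D) ≡ (A × B × C × D) → Set
      last-component {D = D} _ = D

  closing-edge : ∀ x {y z k} (w : Walk (Adj G) y z k) → Adj G z x → ClosingEdge x (vertices w)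
  closing-edge x here                e = e
  closing-edge x (step _ here)       e = closing-edge x here e
  closing-edge x (step _ (step f w)) e = closing-edge x (step f w) e

  acyclic⇒¬closable : Acyclic G → ∀ {a b k} (w : Walk (Adj G) a b (suc (suc k))) → Simple w → ¬ Adj G b a
  acyclic⇒¬closable acyclic w@(step _ w′) simple e =
    acyclic (vertices w) (subst (3 ≤_) (≡-sym (length-vertices w)) (s≤s (s≤s (s≤s z≤n))) ,
                          simple , linked-vertices w , closing-edge _ w′ e)

  -- If two simple walks leave x along different edges, joining them gives a cycle through x.
  acyclic⇒simple-walks-equal-length : Acyclic G → ∀ {x z k₁ k₂} (w₁ : Walk (Adj G) x z k₁) (w₂ : Walk (Adj G) x z k₂) →
                                      Simple w₁ → Simple w₂ → k₁ ≡ k₂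
  acyclic⇒simple-walks-equal-length acyclic here here _ _ = refl
  acyclic⇒simple-walks-equal-length acyclic here (step _ w₂) _ (x∉ ∷ _) = ⊥-elim (All¬⇒¬Any x∉ (end∈vertices w₂))
  acyclic⇒simple-walks-equal-length acyclic (step _ w₁) here (x∉ ∷ _) _ = ⊥-elim (All¬⇒¬Any x∉ (end∈vertices w₁))
  acyclic⇒simple-walks-equal-length acyclic (step {y = y₁} e₁ w₁) (step {y = y₂} e₂ w₂) (x∉₁ ∷ simple₁) (x∉₂ ∷ simple₂)
    with y₁ ≟ᶠ y₂
  ... | yes refl = cong suc (acyclic⇒simple-walks-equal-length acyclic w₁ w₂ simple₁ simple₂)
  ... | no y₁≢y₂ with erase-loops (w₁ ++ʷ reverseʷ (sym G) w₂)
  ...   | zero  , _ , here , _ = ⊥-elim (y₁≢y₂ refl)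
  ...   | suc _ , _ , w , simple , sub =
    ⊥-elim (acyclic⇒¬closable acyclic (step e₁ w) (All.tabulate x∉w ∷ simple) (sym G e₂))
    where
      x∉w : ∀ {a} → a ∈ vertices w → _ ≢ a
      x∉w a∈ refl with ∈-++⁻ (vertices w₁) (vertices-++ʷ w₁ _ (sub a∈))
      ... | inj₁ x∈₁ = All¬⇒¬Any x∉₁ x∈₁
      ... | inj₂ x∈₂ = All¬⇒¬Any x∉₂ (vertices-reverseʷ (sym G) w₂ x∈₂)

module Tree {n : ℕ} (T : Graph n) (tree : IsTree T) where

  simple⇒shortest : ∀ {x y k} (w : Walk (Adj T) x y k) → Simple w → ∀ {k′} → Walk (Adj T) x y k′ → k ≤ k′
  simple⇒shortest w simple w′ with erase-loops w′
  ... | _ , k″≤k′ , w″ , simple″ , _ =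
    subst (_≤ _) (≡-sym (acyclic⇒simple-walks-equal-length T (proj₂ tree) w w″ simple simple″)) k″≤k′

  shortest : ∀ x y → ∃ (Dist (Adj T) x y)
  shortest x y with erase-loops (proj₂ (proj₁ tree x y))
  ... | k , _ , w , simple , _ = k , w , λ _ → simple⇒shortest w simple

  dist : Fin n → Fin n → ℕ
  dist x y = proj₁ (shortest x y)

  geodesic : ∀ x y → Walk (Adj T) x y (dist x y)
  geodesic x y = proj₁ (proj₂ (shortest x y))

  dist-minimal : ∀ {x y k} → Walk (Adj T) x y k → dist x y ≤ k
  dist-minimal {x} {y} {k} = proj₂ (proj₂ (shortest x y)) k

  within? : ∀ c x r → Dec (Within (Adj T) c x r)
  within? c x r with dist c x ≤? r
  ... | yes d≤r = yes (dist c x , d≤r , geodesic c x)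
  ... | no d≰r  = no λ (_ , k≤r , w) → d≰r (≤-trans (dist-minimal w) k≤r)

module _ {n : ℕ} {R : Fin n → Fin n → Set} where

  -- Vertices possibly missed by balls reaching α past point 0 and β past point d, with an extra
  -- edge joining these two points.
  data Exposed {d} (L : Ruler R d) (α β M : ℕ) (x : Fin n) : Set where
    past-end   : ∀ {t} → Walk R (point L d) x t → β ≤ t → t + 2 ≤ α → Exposed L α β M x
    past-start : ∀ {t} → Walk R (point L 0) x t → α ≤ t → t + 2 ≤ β → Exposed L α β M x
    hanging    : ∀ {w k} → 1 ≤ w → w + 1 ≤ d → k ≤ M → Walk R (point L w) x k →
                 α ≤ w + k → β ≤ d ∸ w + k → Exposed L α β M x

  exposed-reverse : ∀ {d α β M x} {L : Ruler R d} → Exposed L α β M x → Exposed (reverse-ruler L) β α M x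
  exposed-reverse (past-end wx β≤t t+2≤α) = past-start wx β≤t t+2≤α
  exposed-reverse {d} {x = x} {L} (past-start {t} wx α≤t t+2≤β) =
    past-end (subst (λ i → Walk R (point L i) x t) (≡-sym (n∸n≡0 d)) wx) α≤t t+2≤β
  exposed-reverse {d} {α} {x = x} {L} (hanging {w} {k} 1≤w w+1≤d k≤M wx α≤w+k β≤d∸w+k) =
    hanging 1≤d∸w d∸w+1≤d k≤M (subst (λ i → Walk R (point L i) x k) (≡-sym d∸[d∸w]≡w) wx)
            β≤d∸w+k (subst (λ i → α ≤ i + k) (≡-sym d∸[d∸w]≡w) α≤w+k)
    where
      w≤d : w ≤ d
      w≤d = ≤-trans (m≤m+n w 1) w+1≤d
      d∸[d∸w]≡w : d ∸ (d ∸ w) ≡ w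
      d∸[d∸w]≡w = m∸[m∸n]≡n w≤d
      1≤d∸w : 1 ≤ d ∸ w
      1≤d∸w = m+n≤o⇒m≤o∸n 1 (subst (_≤ d) (+-comm w 1) w+1≤d)
      d∸w+1≤d : d ∸ w + 1 ≤ d
      d∸w+1≤d = subst (d ∸ w + 1 ≤_) (m∸n+n≡m w≤d) (+-monoʳ-≤ (d ∸ w) 1≤w)

  exposed-centre-oriented : ∀ {d α β M p} (L : Ruler R d) → β ≤ α → α ≤ p → d + 2 * M ≤ 2 * p + 2 →
                            ∃ λ σ → ∀ {x} → Exposed L α β M x → Within R (point L σ) x p
  exposed-centre-oriented {d} {α} {β} {M} {p} L β≤α α≤p short
    with centre-index {d} {M} {p} {α} α≤p short
  ... | σ , σ≤d , α-bound , M-bound , low = σ , covers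
    where
      open ≤-Reasoning

      covers : ∀ {x} → Exposed L α β M x → Within R (point L σ) x p
      covers (past-end {t} wx _ t+2≤α) =
        _ , ∣a-b∣+k≤p (+-mono-≤ σ≤d t≤p) d+t≤σ+p , between L σ≤d ≤-refl ++ʷ wx
        where
          t≤p : t ≤ p
          t≤p = ≤-trans (m≤m+n t 2) (≤-trans t+2≤α α≤p)
          d+t≤σ+p : d + t ≤ σ + p
          d+t≤σ+p = +-cancelʳ-≤ 2 (d + t) (σ + p) (begin
            d + t + 2   ≡⟨ +-assoc d t 2 ⟩
            d + (t + 2) ≤⟨ +-monoʳ-≤ d t+2≤α ⟩
            d + α       ≤⟨ α-bound ⟩
            σ + (2 + p) ≡⟨ cong (σ +_) (+-comm 2 p) ⟩
            σ + (p + 2) ≡⟨ +-assoc σ p 2 ⟨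
            σ + p + 2   ∎)
      covers (past-start {t} _ α≤t t+2≤β) = ⊥-elim (m+1+n≰m t (≤-trans t+2≤β (≤-trans β≤α α≤t)))
      covers (hanging {w} {k} 1≤w w+1≤d k≤M wx α≤w+k _) =
        _ , ∣a-b∣+k≤p σ+k≤w+p w+k≤σ+p , between L σ≤d (≤-trans (m≤m+n w 1) w+1≤d) ++ʷ wx
        where
          w+k≤σ+p : w + k ≤ σ + p
          w+k≤σ+p = +-cancelʳ-≤ 1 (w + k) (σ + p) (begin
            w + k + 1   ≡⟨ swap w k 1 ⟩
            w + 1 + k   ≤⟨ +-mono-≤ w+1≤d k≤M ⟩
            d + M       ≤⟨ M-bound ⟩
            σ + (1 + p) ≡⟨ cong (σ +_) (+-comm 1 p) ⟩
            σ + (p + 1) ≡⟨ +-assoc σ p 1 ⟨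
            σ + p + 1   ∎)
            where
              swap : ∀ a b c → a + b + c ≡ a + c + b
              swap = solve-∀
          σ+k≤w+p : σ + k ≤ w + p
          σ+k≤w+p = [ via-α , via-M ]′ low
            where
              via-α : σ + 2 * M ≤ p + α → σ + k ≤ w + p
              via-α σ+2M≤p+α = +-cancelʳ-≤ k (σ + k) (w + p) (begin
                  σ + k + k   ≡⟨ double σ k ⟩
                  σ + 2 * k   ≤⟨ +-monoʳ-≤ σ (*-monoʳ-≤ 2 k≤M) ⟩
                  σ + 2 * M   ≤⟨ σ+2M≤p+α ⟩
                  p + α       ≤⟨ +-monoʳ-≤ p α≤w+k ⟩
                  p + (w + k) ≡⟨ reorder p w k ⟩
                  w + p + k   ∎)
                where
                  double : ∀ a b → a + b + b ≡ a + 2 * b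
                  double = solve-∀
                  reorder : ∀ a b c → a + (b + c) ≡ b + a + c
                  reorder = solve-∀
              via-M : σ + M ≤ p + 1 → σ + k ≤ w + p
              via-M σ+M≤p+1 = begin
                  σ + k       ≤⟨ +-monoʳ-≤ σ k≤M ⟩
                  σ + M       ≤⟨ σ+M≤p+1 ⟩
                  p + 1       ≤⟨ +-monoʳ-≤ p 1≤w ⟩
                  p + w       ≡⟨ +-comm p w ⟩
                  w + p       ∎

  exposed-centre : ∀ {d α β M p} (L : Ruler R d) → α ≤ p → β ≤ p → d + 2 * M ≤ 2 * p + 2 →
                   ∃ λ z → ∀ {x} → Exposed L α β M x → Within R z x p
  exposed-centre {α = α} {β} L α≤p β≤p short with ≤-total β α
  ... | inj₁ β≤α = let σ , covers = exposed-centre-oriented L β≤α α≤p short in point L σ , covers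
  ... | inj₂ α≤β = let σ , covers = exposed-centre-oriented (reverse-ruler L) α≤β β≤p short
                   in _ , λ e → covers (exposed-reverse e)

module _ {X : Set} (p : ℕ) where

  extend-centres : (B : List ℕ) → (Fin (length (remove B p)) → X) → X → Fin (length B) → X
  extend-centres (b ∷ B) c z j with b ≡ᵇ p
  extend-centres (b ∷ B) c z zero    | true  = z
  extend-centres (b ∷ B) c z (suc j) | true  = extend-centres B c z j
  extend-centres (b ∷ B) c z zero    | false = c zero
  extend-centres (b ∷ B) c z (suc j) | false = extend-centres B (c ∘ suc) z j

  extend-centres-kept : ∀ B c z i → ∃ λ j → extend-centres B c z j ≡ c i × lookup B j ≡ lookup (remove B p) i
  extend-centres-kept (b ∷ B) c z i with b ≡ᵇ p
  ... | true = let j , eq₁ , eq₂ = extend-centres-kept B c z i in suc j , eq₁ , eq₂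
  extend-centres-kept (b ∷ B) c z zero    | false = zero , refl , refl
  extend-centres-kept (b ∷ B) c z (suc i) | false =
    let j , eq₁ , eq₂ = extend-centres-kept B (c ∘ suc) z i in suc j , eq₁ , eq₂

  extend-centres-new : ∀ B c z → p ∈ B → ∃ λ j → extend-centres B c z j ≡ z × lookup B j ≡ p
  extend-centres-new (b ∷ B) c z p∈ with b ≡ᵇ p in b≡ᵇp
  extend-centres-new (b ∷ B) c z p∈          | true  = zero , refl , ≡ᵇ⇒≡ b p (subst T (≡-sym b≡ᵇp) tt)
  extend-centres-new (b ∷ B) c z (here refl) | false = ⊥-elim (subst T b≡ᵇp (≡⇒≡ᵇ b b refl))
  extend-centres-new (b ∷ B) c z (there p∈)  | false =
    let j , eq₁ , eq₂ = extend-centres-new B (c ∘ suc) z p∈ in suc j , eq₁ , eq₂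

burnable-extend : ∀ {n} {R : Fin n → Fin n → Set} {B p} → p ∈ B →
                  (c : Fin (length (remove B p)) → Fin n) (z : Fin n) →
                  (∀ x → (∃ λ i → Within R (c i) x (lookup (remove B p) i)) ⊎ Within R z x p) →
                  Burnable R (λ _ → ⊤) B
burnable-extend {R = R} {B} {p} p∈B c z covers =
  extend-centres p B c z , (λ _ → tt) , λ x _ → [ old , new ]′ (covers x)
  where
    old : ∀ {x} → ∃ (λ i → Within R (c i) x (lookup (remove B p) i)) → _
    old (i , k , k≤r , w) with extend-centres-kept p B c z i
    ... | j , centre≡ , radius≡ = j , k , subst (k ≤_) (≡-sym radius≡) k≤r , subst (λ y → Walk R y _ k) (≡-sym centre≡) w
    new : ∀ {x} → Within R z x p → _
    new (k , k≤p , w) with extend-centres-new p B c z p∈B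
    ... | j , centre≡ , radius≡ = j , k , subst (k ≤_) (≡-sym radius≡) k≤p , subst (λ y → Walk R y _ k) (≡-sym centre≡) w

remove-max⇒< : ∀ {B p} → (∀ b → b ∈ B → b ≤ p) → ∀ i → lookup (remove B p) i < p
remove-max⇒< {B} {p} max i with ∈-filter⁻ (λ b → ¬? (b ≟ p)) {xs = B} (∈-lookup {xs = remove B p} i)
... | b∈B , b≢p = ≤∧≢⇒< (max _ b∈B) b≢p

module Balls {n : ℕ} (T : Graph n) (tree : IsTree T) {m : ℕ} (c : Fin m → Fin n) (r : Fin m → ℕ) where
  open Tree T tree
  open ≤-Reasoning

  Covered : Fin n → Set
  Covered x = ∃ λ i → Within (Adj T) (c i) x (r i)

  covered? : ∀ x → Dec (Covered x)
  covered? x = any? λ i → within? (c i) x (r i)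

  reach : Fin n → ℕ
  reach a = sup λ i → suc (r i) ∸ dist (c i) a

  reach-covers : ∀ {a y t} → Walk (Adj T) a y t → t < reach a → Covered y
  reach-covers {a} w t<reach with <sup⇒ _ t<reach
  ... | i , t<1+r∸d = i , _ , <1+∸⇒+≤ t<1+r∸d , geodesic (c i) a ++ʷ w

  reach-past : ∀ {i a k₁ k₂} → Walk (Adj T) (c i) a k₁ → k₁ + 1 + k₂ ≤ r i → k₂ + 2 ≤ reach a
  reach-past {i} {a} {k₁} {k₂} w k≤r = ≤-trans (m+n≤o⇒m≤o∸n (k₂ + 2) (begin
    k₂ + 2 + dist (c i) a ≤⟨ +-monoʳ-≤ (k₂ + 2) (dist-minimal w) ⟩
    k₂ + 2 + k₁           ≡⟨ reorder k₁ k₂ ⟩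
    suc (k₁ + 1 + k₂)     ≤⟨ s≤s k≤r ⟩
    suc (r i)             ∎)) (f≤sup _ i)
    where
      reorder : ∀ a b → b + 2 + a ≡ suc (a + 1 + b)
      reorder = solve-∀

  reach≤ : ∀ {a b} → (∀ i → r i < b) → reach a ≤ b
  reach≤ {a} r<b = sup≤ _ λ i → ≤-trans (m∸n≤m (suc (r i)) (dist (c i) a)) (r<b i)

module Path {n : ℕ} (T : Graph n) (tree : IsTree T) (u v : Fin n) (I : List (Fin n))
            (path : IsPath T (u ∷ I ++ v ∷ [])) where
  open Setting T u v I
  open Tree T tree

  d : ℕ
  d = suc (length I)

  path-walk : Walk (Adj T) u v d
  path-walk = linked⇒walk u I (proj₂ path)

  path-walk-simple : Simple path-walk
  path-walk-simple = subst Unique (≡-sym (vertices-linked⇒walk u I (proj₂ path))) (proj₁ path)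

  ruler : Ruler (Adj T) d
  ruler = walk-ruler (sym T) path-walk

  point-d≡v : point ruler d ≡ v
  point-d≡v = vertex-at-end path-walk

  from-v : ∀ {w} → w ≤ d → Walk (Adj T) v (point ruler w) (d ∸ w)
  from-v {w} w≤d = subst₂ (λ y k → Walk (Adj T) y (point ruler w) k) point-d≡v (m≤n⇒∣n-m∣≡n∸m w≤d) (between ruler ≤-refl w≤d)

  u∉I : u ∉ I
  u∉I u∈I with proj₁ path
  ... | u∉ ∷ _ = All¬⇒¬Any u∉ (∈-++⁺ˡ u∈I)

  v∉I : v ∉ I
  v∉I with proj₁ path
  ... | _ ∷ unique = unique-snoc⇒∉ I unique

  data Split (c x : Fin n) (k : ℕ) : Set where
    direct : ∀ {k′} → k′ ≤ k → Walk (Adj T) c x k′ → Split c x k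
    via-uv : ∀ {k₁ k₂} → k₁ + 1 + k₂ ≤ k → Walk (Adj T) c u k₁ → Walk (Adj T) v x k₂ → Split c x k
    via-vu : ∀ {k₁ k₂} → k₁ + 1 + k₂ ≤ k → Walk (Adj T) c v k₁ → Walk (Adj T) u x k₂ → Split c x k

  edge-kind : ∀ {x y} → Adj' x y → Adj T x y ⊎ (x ≡ u × y ≡ v) ⊎ (x ≡ v × y ≡ u)
  edge-kind (inj₁ (_ , _ , e))        = inj₁ e
  edge-kind (inj₂ (inj₁ (_ , _ , e))) = inj₁ e
  edge-kind (inj₂ (inj₂ uv⊎vu))       = inj₂ uv⊎vu

  split : ∀ {c x k} → Walk Adj' c x k → Split c x k
  split here = direct z≤n here
  split (step e w) with edge-kind e | split w
  ... | inj₁ e′                 | direct k′≤k w′     = direct (s≤s k′≤k) (step e′ w′)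
  ... | inj₁ e′                 | via-uv k≤ w₁ w₂    = via-uv (s≤s k≤) (step e′ w₁) w₂
  ... | inj₁ e′                 | via-vu k≤ w₁ w₂    = via-vu (s≤s k≤) (step e′ w₁) w₂
  ... | inj₂ (inj₁ (refl , refl)) | direct k′≤k w′   = via-uv (s≤s k′≤k) here w′
  ... | inj₂ (inj₁ (refl , refl)) | via-uv k≤ _ w₂   = via-uv (s≤s (m+1+n≤o⇒n≤o k≤)) here w₂
  ... | inj₂ (inj₁ (refl , refl)) | via-vu k≤ _ w₂   = direct (m≤n⇒m≤1+n (m+1+n≤o⇒n≤o k≤)) w₂
  ... | inj₂ (inj₂ (refl , refl)) | direct k′≤k w′   = via-vu (s≤s k′≤k) here w′
  ... | inj₂ (inj₂ (refl , refl)) | via-uv k≤ _ w₂   = direct (m≤n⇒m≤1+n (m+1+n≤o⇒n≤o k≤)) w₂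
  ... | inj₂ (inj₂ (refl , refl)) | via-vu k≤ _ w₂   = via-vu (s≤s (m+1+n≤o⇒n≤o k≤)) here w₂

  P : List (Fin n)
  P = u ∷ I ++ v ∷ []

  module _ (x : Fin n) where

    nearest : Fin n
    nearest = argmin (λ y → dist y x) u (I ++ v ∷ [])

    nearest∈P : nearest ∈ P
    nearest∈P with argmin-sel (λ y → dist y x) u (I ++ v ∷ [])
    ... | inj₁ eq = here eq
    ... | inj₂ y∈ = there y∈

    nearest-minimal : ∀ {y} → y ∈ P → dist nearest x ≤ dist y x
    nearest-minimal (here refl) = f[argmin]≤f[⊤] {f = λ y → dist y x} u (I ++ v ∷ [])
    nearest-minimal (there y∈) = All.lookup (f[argmin]≤f[xs] {f = λ y → dist y x} u (I ++ v ∷ [])) y∈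

    dist-to-P : DistToSet (Adj T) P x (dist nearest x)
    dist-to-P = (nearest , nearest∈P , geodesic nearest x) , λ _ _ y∈ w → ≤-trans (nearest-minimal y∈) (dist-minimal w)

  -- A vertex outside T₁ ∪ T₂ is nearest to an interior vertex of P: a geodesic from u or v would avoid I.
  outside⇒interior-nearest : ∀ {x} → Outside x →
    ∃ λ w → 1 ≤ w × w + 1 ≤ d × Walk (Adj T) (point ruler w) x (dist (nearest x) x)
  outside⇒interior-nearest {x} out
    with vertex-at-index path-walk (subst (nearest x ∈_) (≡-sym (vertices-linked⇒walk u I (proj₂ path))) (nearest∈P x))
  ... | w , w≤d , at-w≡nearest = position w w≤d (subst (λ y → Walk (Adj T) y x k) (≡-sym at-w≡nearest) (geodesic _ x))
    where
      k = dist (nearest x) x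

      far-from-I : ∀ {q k′} → q ∈ I → Walk (Adj T) q x k′ → k ≤ k′
      far-from-I q∈I w = ≤-trans (nearest-minimal x (there (∈-++⁺ˡ q∈I))) (dist-minimal w)

      position : ∀ w → w ≤ d → Walk (Adj T) (point ruler w) x k →
                 ∃ λ w → 1 ≤ w × w + 1 ≤ d × Walk (Adj T) (point ruler w) x k
      position zero _ wx = ⊥-elim (out (inj₁ (k , avoiding {Q = _∈ I} wx u∉I far-from-I)))
      position (suc w) w≤d wx with suc w ≟ d
      ... | yes refl = ⊥-elim (out (inj₂ (k , avoiding {Q = _∈ I} (subst (λ y → Walk (Adj T) y x k) point-d≡v wx) v∉I far-from-I)))
      ... | no w≢d   = suc w , s≤s z≤n , subst (_≤ d) (+-comm 1 (suc w)) (≤∧≢⇒< w≤d w≢d) , wx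

  module Cover {m : ℕ} (c : Fin m → Fin n) (r : Fin m → ℕ) (M : ℕ) where
    open Balls T tree c r

    Uncovered : Fin n → Set
    Uncovered = Exposed ruler (reach u) (reach v) M

    through : ∀ {i a b x k₁ k₂} → Walk (Adj T) (c i) a k₁ → Walk (Adj T) b x k₂ → k₁ + 1 + k₂ ≤ r i →
              Covered x ⊎ (reach b ≤ k₂ × k₂ + 2 ≤ reach a)
    through {b = b} {k₂ = k₂} w₁ w₂ k≤r with k₂ <? reach b
    ... | yes k₂<reach = inj₁ (reach-covers w₂ k₂<reach)
    ... | no  k₂≮reach = inj₂ (≮⇒≥ k₂≮reach , reach-past w₁ k≤r)

    inside : ∀ {i x k} → Walk Adj' (c i) x k → k ≤ r i → Covered x ⊎ Uncovered x
    inside {i} w k≤r with split w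
    ... | direct k′≤k w′ = inj₁ (i , _ , ≤-trans k′≤k k≤r , w′)
    ... | via-uv k≤ w₁ w₂ = Sum.map₂ (λ (β≤ , ≤α) → past-end (subst (λ y → Walk (Adj T) y _ _) (≡-sym point-d≡v) w₂) β≤ ≤α)
                                     (through w₁ w₂ (≤-trans k≤ k≤r))
    ... | via-vu k≤ w₁ w₂ = Sum.map₂ (λ (α≤ , ≤β) → past-start w₂ α≤ ≤β) (through w₁ w₂ (≤-trans k≤ k≤r))

    outside : ∀ {x} → Outside x → IsMaxOut P M → Covered x ⊎ Uncovered x
    outside {x} out maxOut with outside⇒interior-nearest out
    ... | w , 1≤w , w+1≤d , wx = classify
      where
        k = dist (nearest x) x
        w≤d = ≤-trans (m≤m+n w 1) w+1≤d

        classify : Covered x ⊎ Uncovered x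
        classify with w + k <? reach u | d ∸ w + k <? reach v
        ... | yes close-to-u | _             = inj₁ (reach-covers (between ruler z≤n w≤d ++ʷ wx) close-to-u)
        ... | no _           | yes close-to-v = inj₁ (reach-covers (from-v w≤d ++ʷ wx) close-to-v)
        ... | no far-from-u  | no far-from-v  =
          inj₂ (hanging 1≤w w+1≤d (proj₁ maxOut x k out (dist-to-P x)) wx (≮⇒≥ far-from-u) (≮⇒≥ far-from-v))

lemma2p6 : ∀ {n} (T : Graph n) → IsTree T →
    (B : List ℕ) → Unique B → B ≢ [] →
    (p : ℕ) → p ∈ B → (∀ b → b ∈ B → b ≤ p) →
    (u v : Fin n) (I : List (Fin n)) → u ≢ v →
    IsPath T (u ∷ I ++ v ∷ []) →
    Burnable (Setting.Adj' T u v I) (Setting.V' T u v I) (remove B p) →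
    (duv M : ℕ) → Dist (Adj T) u v duv →
    Setting.IsMaxOut T u v I (u ∷ I ++ v ∷ []) M →
    duv + 2 * M < 2 * p + 3 →
    Burnable (Adj T) (λ _ → ⊤) B
lemma2p6 T tree B _ _ p p∈B p-max u v I _ path (c , _ , burns-T′) duv M (uv-walk , _) maxOut bound =
  -- Membership in T₁ ∪ T₂ is not decidable, but coverage is.
  burnable-extend p∈B c z λ x → decidable-stable (covered? x ⊎-dec within? z x p) λ missed →
    missed (settle (outside (λ x∈T′ → missed (settle (in-T′ x∈T′))) maxOut))
  where
    open Tree T tree
    open Path T tree u v I path
    open Balls T tree c (lookup (remove B p))
    open Cover c (lookup (remove B p)) M

    short : d + 2 * M ≤ 2 * p + 2
    short = ≤-trans (+-monoˡ-≤ (2 * M) (simple⇒shortest path-walk path-walk-simple uv-walk))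
                    (≤-pred (subst (suc (duv + 2 * M) ≤_) (+-suc (2 * p) 2) bound))

    centre = exposed-centre ruler (reach≤ (remove-max⇒< p-max)) (reach≤ (remove-max⇒< p-max)) short
    z = proj₁ centre

    settle : ∀ {x} → Covered x ⊎ Uncovered x → Covered x ⊎ Within (Adj T) z x p
    settle = Sum.map₂ (proj₂ centre)

    in-T′ : ∀ {x} → Setting.V' T u v I x → Covered x ⊎ Uncovered x
    in-T′ {x} x∈T′ = let _ , _ , k≤r , w = burns-T′ x x∈T′ in inside w k≤r
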